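{- Let $k\ge1$ be an integer and let $G=(V,E)$ be a bipartite graph. Set $G_0=G$ and, for $i=1,\dots,k$, let $M^{(i)}$ be an arbitrary maximum-cardinality matching of $G_{i-1}$ and let $G_i$ be obtained from $G_{i-1}$ by deleting the edges of $M^{(i)}$ (keeping all vertices). Let $I_k$ be a maximum independent set of $G_k$ and let $I^*_k$ be a maximum-cardinality $k$-dependent set of $G$. Then $$\frac{|I_k|}{|I^*_k|}\ge \frac12+\frac{1}{2(k+1)}.$$
   Context: All graphs are simple and undirected. For an integer $k\ge0$, a subset $S\subseteq V$ is a $k$-dependent set of $G$ if every vertex has degree at most $k$ in the induced subgraph $G[S]$. -}

module Defs where

open import Data.Nat using (ℕ; zero; suc; _≤_; _<_)
open import Data.Bool using (Bool; true; false; _∧_; not; if_then_else_)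
open import Data.Fin using (Fin; _<?_)
open import Data.Fin.Subset using (Subset; _∈_; _∩_; ∣_∣; inside; outside)
open import Data.Vec using (tabulate)
open import Data.Product using (Σ; ∃; _×_)
open import Relation.Nullary.Decidable using (⌊_⌋)
open import Relation.Binary.PropositionalEquality using (_≡_; _≢_)

record Graph (n : ℕ) : Set where
  field
    adj     : Fin n → Fin n → Bool
    sym     : ∀ u v → adj u v ≡ adj v u
    irrefl  : ∀ u → adj u u ≡ false
open Graph public

IsBipartite : ∀ {n} → Graph n → Set
IsBipartite {n} G = Σ (Fin n → Bool) λ c → ∀ u v → adj G u v ≡ true → c u ≢ c v

toSubset : ∀ {n} → (Fin n → Bool) → Subset n
toSubset f = tabulate (λ v → if f v then inside else outside)

sumFin : ∀ {n} → (Fin n → ℕ) → ℕ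
sumFin {zero}  f = 0
sumFin {suc n} f = f Fin.zero Data.Nat.+ sumFin (λ i → f (Fin.suc i))
  where import Data.Fin as Fin

edgeCount : ∀ {n} → Graph n → ℕ
edgeCount G = sumFin (λ u → ∣ toSubset (λ v → ⌊ u <? v ⌋ ∧ adj G u v) ∣)

IsMatching : ∀ {n} → Graph n → Graph n → Set
IsMatching {n} G M =
  (∀ u v → adj M u v ≡ true → adj G u v ≡ true) ×
  (∀ u v w → adj M u v ≡ true → adj M u w ≡ true → v ≡ w)

IsMaxMatching : ∀ {n} → Graph n → Graph n → Set
IsMaxMatching {n} G M =
  IsMatching G M × (∀ (M′ : Graph n) → IsMatching G M′ → edgeCount M′ ≤ edgeCount M)

deleteEdges : ∀ {n} → Graph n → Graph n → Graph n
deleteEdges G M = record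
  { adj    = λ u v → adj G u v ∧ not (adj M u v)
  ; sym    = λ u v → cong₂ (λ a b → a ∧ not b) (sym G u v) (sym M u v)
  ; irrefl = λ u → cong (λ a → a ∧ not (adj M u u)) (irrefl G u)
  }
  where open import Relation.Binary.PropositionalEquality using (cong; cong₂)

-- G_0 = G, G_{i+1} = G_i minus the edges of M^{(i+1)} = Ms i.
iterDelete : ∀ {n} → Graph n → (ℕ → Graph n) → ℕ → Graph n
iterDelete G Ms zero    = G
iterDelete G Ms (suc i) = deleteEdges (iterDelete G Ms i) (Ms i)

IsIndependent : ∀ {n} → Graph n → Subset n → Set
IsIndependent G S = ∀ u v → u ∈ S → v ∈ S → adj G u v ≡ false

IsMaxIndependent : ∀ {n} → Graph n → Subset n → Set
IsMaxIndependent {n} G S =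
  IsIndependent G S × (∀ (T : Subset n) → IsIndependent G T → ∣ T ∣ ≤ ∣ S ∣)

degIn : ∀ {n} → Graph n → Subset n → Fin n → ℕ
degIn G S u = ∣ S ∩ toSubset (adj G u) ∣

IsKDependent : ∀ {n} → ℕ → Graph n → Subset n → Set
IsKDependent k G S = ∀ u → u ∈ S → degIn G S u ≤ k

IsMaxKDependent : ∀ {n} → ℕ → Graph n → Subset n → Set
IsMaxKDependent {n} k G S =
  IsKDependent k G S × (∀ (T : Subset n) → IsKDependent k G T → ∣ T ∣ ≤ ∣ S ∣)

{-# OPTIONS --safe #-}
-- Let S = I*ₖ, let S̄ be its complement and let N be a maximum matching of Gₖ. Since N is a
-- matching of every Gᵢ, each M⁽ⁱ⁾ has at least |N| edges, and at most |S̄| edges of any matching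
-- meet S̄; so each of M⁽¹⁾, …, M⁽ᵏ⁾, N contributes at least |N| − |S̄| edges to G[S]. These k + 1
-- edge sets are disjoint and G[S] has at most k|S|/2 edges, whence (k + 1)(|N| − |S̄|) ≤ k|S|/2.
-- By Kőnig's theorem (in Rizzi's inductive form) Gₖ has a vertex cover C with |C| ≤ |N|; its
-- complement is independent, so |Iₖ| ≥ n − |N| = |S| + |S̄| − |N|, and the bound follows.

module Submission where

open import Defs hiding (sym)
open import Data.Bool using (Bool; true; false; _∧_; _∨_; not; if_then_else_)
open import Data.Bool.Properties as Bool
  using (∧-comm; ∨-comm; ∧-identityʳ; ∨-identityʳ; ∧-zeroʳ; ∨-zeroʳ; ∧-inverseʳ; ∨-inverseʳ; not-involutive)
open import Data.Empty using (⊥; ⊥-elim)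
open import Data.Fin using (Fin; zero; suc; _<?_)
open import Data.Fin.Properties using (_≟_; suc-injective; any?; <-asym; <-cmp)
open import Data.Fin.Subset using (Subset; ∣_∣; _∩_; _∈_; inside; outside)
open import Data.Nat using (ℕ; zero; suc; _≤_; _<_; _*_; _+_; z≤n; s≤s; _≤?_)
open import Data.Nat.Properties
  using ( +-*-semiring; +-assoc; +-identityʳ; *-identityˡ; *-identityʳ; *-zeroʳ; *-distribˡ-+
        ; ≤-refl; ≤-reflexive; ≤-trans; ≤-antisym; ≤-pred; <⇒≤; <⇒≱; ≰⇒>; <-≤-trans
        ; m≤m+n; m≤n+m; m<n⇒m<1+n; m≤n⇒m<n∨m≡n
        ; +-mono-≤; +-monoˡ-≤; +-monoʳ-≤; +-monoʳ-<; +-mono-<-≤; +-mono-≤-<; *-monoʳ-≤; +-cancelʳ-≤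
        ; module ≤-Reasoning )
open import Data.Nat.Tactic.RingSolver using (solve-∀)
open import Algebra.Properties.Semiring.Sum +-*-semiring
  using (sum; sum-syntax; sum-cong-≗; sum-replicate-zero; ∑-distrib-+; ∑-comm; *-distribˡ-sum)
open import Data.Product using (_×_; _,_; proj₁; proj₂; ∃)
open import Data.Sum using (_⊎_; inj₁; inj₂; [_,_]′)
open import Data.Vec using ([]; _∷_; lookup)
open import Data.Vec.Properties using (lookup∘tabulate; lookup-zipWith; lookup⇒[]=; []=⇒lookup)
open import Function using (_∘_; flip)
open import Relation.Binary using (tri<; tri≈; tri>)
open import Relation.Binary.PropositionalEquality
  using (_≡_; _≢_; refl; sym; trans; cong; cong₂; subst; subst₂; module ≡-Reasoning)
open import Relation.Nullary using (¬_; Dec; yes; no; does; ¬?)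
open import Relation.Nullary.Decidable using (_×-dec_; ⌊_⌋; dec-true; dec-false; decidable-stable)

∧-true⁻ : ∀ {x y} → x ∧ y ≡ true → x ≡ true × y ≡ true
∧-true⁻ {true} {true} _ = refl , refl

∨-true⁻ : ∀ {x y} → x ∨ y ≡ true → x ≡ true ⊎ y ≡ true
∨-true⁻ {true}  _    = inj₁ refl
∨-true⁻ {false} y≡t = inj₂ y≡t

∨-trueˡ : ∀ {x} y → x ≡ true → x ∨ y ≡ true
∨-trueˡ _ refl = refl

∨-trueʳ : ∀ x {y} → y ≡ true → x ∨ y ≡ true
∨-trueʳ x refl = ∨-zeroʳ x

∨-true-mono : ∀ {x y x′ y′} → (x ≡ true → x′ ≡ true) → (y ≡ true → y′ ≡ true) →
              x ∨ y ≡ true → x′ ∨ y′ ≡ true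
∨-true-mono {y′ = y′} f g x∨y with ∨-true⁻ x∨y
... | inj₁ x≡t = ∨-trueˡ y′ (f x≡t)
... | inj₂ y≡t = ∨-trueʳ _ (g y≡t)

∧-true-monoˡ : ∀ {x x′ y} → (x ≡ true → x′ ≡ true) → x ∧ y ≡ true → x′ ∧ y ≡ true
∧-true-monoˡ {true} x⇒x′ x∧y rewrite x⇒x′ refl = x∧y

true≢false : ∀ {x} → x ≡ true → x ≡ false → ⊥
true≢false refl ()

_==_ : ∀ {n} → Fin n → Fin n → Bool
a == b = does (a ≟ b)

==-refl : ∀ {n} (a : Fin n) → (a == a) ≡ true
==-refl a = dec-true (a ≟ a) refl

==-≢ : ∀ {n} {a b : Fin n} → a ≢ b → (a == b) ≡ false
==-≢ {a = a} {b} = dec-false (a ≟ b)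

==⇒≡ : ∀ {n} {a b : Fin n} → (a == b) ≡ true → a ≡ b
==⇒≡ {a = a} {b} eq with a ≟ b
... | yes a≡b = a≡b

-- Counting

𝟙 : Bool → ℕ
𝟙 true  = 1
𝟙 false = 0

𝟙-mono : ∀ {x y} → (x ≡ true → y ≡ true) → 𝟙 x ≤ 𝟙 y
𝟙-mono {false} _   = z≤n
𝟙-mono {true}  x⇒y rewrite x⇒y refl = ≤-refl

𝟙-∨ : ∀ x y → 𝟙 (x ∨ y) + 𝟙 (x ∧ y) ≡ 𝟙 x + 𝟙 y
𝟙-∨ true  true  = refl
𝟙-∨ true  false = refl
𝟙-∨ false y     = +-identityʳ (𝟙 y)

sum-mono-≤ : ∀ {n} {f g : Fin n → ℕ} → (∀ i → f i ≤ g i) → sum f ≤ sum g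
sum-mono-≤ {zero}  f≤g = z≤n
sum-mono-≤ {suc n} f≤g = +-mono-≤ (f≤g zero) (sum-mono-≤ (f≤g ∘ suc))

sum-mono-< : ∀ {n} {f g : Fin n → ℕ} → (∀ i → f i ≤ g i) → ∀ j → f j < g j → sum f < sum g
sum-mono-< f≤g zero    fj<gj = +-mono-<-≤ fj<gj (sum-mono-≤ (f≤g ∘ suc))
sum-mono-< f≤g (suc j) fj<gj = +-mono-≤-< (f≤g zero) (sum-mono-< (f≤g ∘ suc) j fj<gj)

term≤sum : ∀ {n} (f : Fin n → ℕ) j → f j ≤ sum f
term≤sum f zero    = m≤m+n _ _
term≤sum f (suc j) = ≤-trans (term≤sum (f ∘ suc) j) (m≤n+m _ _)

sum-zero : ∀ {n} {f : Fin n → ℕ} → (∀ i → f i ≡ 0) → sum f ≡ 0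
sum-zero {n} f≡0 = trans (sum-cong-≗ f≡0) (sum-replicate-zero n)

count : ∀ {n} → (Fin n → Bool) → ℕ
count {n} P = ∑[ i < n ] 𝟙 (P i)

count-cong : ∀ {n} {P Q : Fin n → Bool} → (∀ i → P i ≡ Q i) → count P ≡ count Q
count-cong P≗Q = sum-cong-≗ (cong 𝟙 ∘ P≗Q)

count-mono : ∀ {n} {P Q : Fin n → Bool} → (∀ i → P i ≡ true → Q i ≡ true) → count P ≤ count Q
count-mono P⊆Q = sum-mono-≤ (λ i → 𝟙-mono (P⊆Q i))

count-false : ∀ {n} {P : Fin n → Bool} → (∀ i → P i ≡ false) → count P ≡ 0
count-false P≡f = sum-zero (cong 𝟙 ∘ P≡f)

count-true : ∀ n → count {n} (λ _ → true) ≡ n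
count-true zero    = refl
count-true (suc n) = cong suc (count-true n)

count-∨ : ∀ {n} (P Q : Fin n → Bool) →
          count (λ i → P i ∨ Q i) + count (λ i → P i ∧ Q i) ≡ count P + count Q
count-∨ P Q = begin
  count (λ i → P i ∨ Q i) + count (λ i → P i ∧ Q i)
    ≡⟨ ∑-distrib-+ (λ i → 𝟙 (P i ∨ Q i)) (λ i → 𝟙 (P i ∧ Q i)) ⟨
  sum (λ i → 𝟙 (P i ∨ Q i) + 𝟙 (P i ∧ Q i))          ≡⟨ sum-cong-≗ (λ i → 𝟙-∨ (P i) (Q i)) ⟩
  sum (λ i → 𝟙 (P i) + 𝟙 (Q i))                      ≡⟨ ∑-distrib-+ (𝟙 ∘ P) (𝟙 ∘ Q) ⟩
  count P + count Q                                  ∎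
  where open ≡-Reasoning

count-∨-≤ : ∀ {n} (P Q : Fin n → Bool) → count (λ i → P i ∨ Q i) ≤ count P + count Q
count-∨-≤ P Q = ≤-trans (m≤m+n _ _) (≤-reflexive (count-∨ P Q))

count-∁ : ∀ {n} (P : Fin n → Bool) → count P + count (not ∘ P) ≡ n
count-∁ {n} P = begin
  count P + count (not ∘ P)            ≡⟨ count-∨ P (not ∘ P) ⟨
  count (λ i → P i ∨ not (P i)) + count (λ i → P i ∧ not (P i))
    ≡⟨ cong₂ _+_ (count-cong (∨-inverseʳ ∘ P)) (count-false (∧-inverseʳ ∘ P)) ⟩
  count {n} (λ _ → true) + 0           ≡⟨ +-identityʳ _ ⟩
  count {n} (λ _ → true)               ≡⟨ count-true n ⟩
  n                                    ∎
  where open ≡-Reasoning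

count≤1 : ∀ {n} (P : Fin n → Bool) → (∀ i j → P i ≡ true → P j ≡ true → i ≡ j) → count P ≤ 1
count≤1 {zero}  P unique = z≤n
count≤1 {suc n} P unique with P zero in P₀
... | true  = ≤-reflexive (cong suc (count-false rest-false))
  where
  rest-false : ∀ i → P (suc i) ≡ false
  rest-false i with P (suc i) in Pᵢ
  ... | true  with () ← unique zero (suc i) P₀ Pᵢ
  ... | false = refl
... | false = count≤1 (P ∘ suc) (λ i j Pi Pj → suc-injective (unique (suc i) (suc j) Pi Pj))

count≥2 : ∀ {n} (P : Fin n → Bool) {i j} → P i ≡ true → P j ≡ true → i ≢ j → 2 ≤ count P
count≥2 P {zero}  {zero}  _  _  i≢j = ⊥-elim (i≢j refl)
count≥2 P {zero}  {suc j} Pi Pj _ rewrite Pi = s≤s (≤-trans (𝟙-mono (λ _ → Pj)) (term≤sum (𝟙 ∘ P ∘ suc) j))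
count≥2 P {suc i} {zero}  Pi Pj _ rewrite Pj = s≤s (≤-trans (𝟙-mono (λ _ → Pi)) (term≤sum (𝟙 ∘ P ∘ suc) i))
count≥2 P {suc i} {suc j} Pi Pj i≢j =
  ≤-trans (count≥2 (P ∘ suc) Pi Pj (i≢j ∘ cong suc)) (m≤n+m _ _)

count≤2 : ∀ {n} (P : Fin n → Bool) →
          (∀ {i j k} → P i ≡ true → P j ≡ true → P k ≡ true → i ≢ j → i ≢ k → j ≢ k → ⊥) →
          count P ≤ 2
count≤2 {zero}  P no-three = z≤n
count≤2 {suc n} P no-three with P zero in P₀
... | true  = s≤s (count≤1 (P ∘ suc) unique)
  where
  unique : ∀ i j → P (suc i) ≡ true → P (suc j) ≡ true → i ≡ j
  unique i j Pi Pj with i ≟ j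
  ... | yes i≡j = i≡j
  ... | no  i≢j = ⊥-elim (no-three P₀ Pi Pj (λ ()) (λ ()) (i≢j ∘ suc-injective))
... | false = count≤2 (P ∘ suc) λ Pi Pj Pk i≢j i≢k j≢k →
  no-three Pi Pj Pk (i≢j ∘ suc-injective) (i≢k ∘ suc-injective) (j≢k ∘ suc-injective)

count-singleton : ∀ {n} (x : Fin n) → count (_== x) ≡ 1
count-singleton x = ≤-antisym
  (count≤1 (_== x) (λ i j i≡x j≡x → trans (==⇒≡ i≡x) (sym (==⇒≡ j≡x))))
  (≤-trans (𝟙-mono (λ _ → ==-refl x)) (term≤sum (𝟙 ∘ (_== x)) x))

count-insert : ∀ {n} (P : Fin n → Bool) x → count (λ i → P i ∨ (i == x)) ≤ count P + 1
count-insert P x = ≤-trans (count-∨-≤ P (_== x)) (≤-reflexive (cong (count P +_) (count-singleton x)))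

count-remove : ∀ {n} (P : Fin n → Bool) {x} → P x ≡ true → count (λ i → P i ∧ not (i == x)) + 1 ≤ count P
count-remove P {x} Px = begin
  count P-x + 1                          ≡⟨ cong (count P-x +_) (count-singleton x) ⟨
  count P-x + count (_== x)              ≡⟨ ∑-distrib-+ (𝟙 ∘ P-x) (𝟙 ∘ (_== x)) ⟨
  sum (λ i → 𝟙 (P-x i) + 𝟙 (i == x))     ≤⟨ sum-mono-≤ split ⟩
  count P                                ∎
  where
  open ≤-Reasoning
  P-x = λ i → P i ∧ not (i == x)
  split : ∀ i → 𝟙 (P i ∧ not (i == x)) + 𝟙 (i == x) ≤ 𝟙 (P i)
  split i with i ≟ x
  ... | yes refl rewrite Px = ≤-refl
  ... | no  _    rewrite ∧-identityʳ (P i) = ≤-reflexive (+-identityʳ _)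

Relation : ℕ → Set
Relation n = Fin n → Fin n → Bool

degree : ∀ {n} → Relation n → Fin n → ℕ
degree A a = count (A a)

-- Ordered pairs are counted, so a graph has twice as many arcs as edges (see handshake).
arcs : ∀ {n} → Relation n → ℕ
arcs {n} A = ∑[ a < n ] degree A a

_↾_ : ∀ {n} → Relation n → (Fin n → Bool) → Relation n
(A ↾ P) a b = A a b ∧ (P a ∧ P b)

∁ : ∀ {n} → (Fin n → Bool) → Fin n → Bool
∁ P = not ∘ P

link : ∀ {n} → Fin n → Fin n → Relation n
link u v a b = (a == u ∧ b == v) ∨ (a == v ∧ b == u)

∣∣≡count : ∀ {n} (S : Subset n) → ∣ S ∣ ≡ count (lookup S)
∣∣≡count []          = refl
∣∣≡count (true ∷ S)  = cong suc (∣∣≡count S)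
∣∣≡count (false ∷ S) = ∣∣≡count S

lookup-toSubset : ∀ {n} (P : Fin n → Bool) i → lookup (toSubset P) i ≡ P i
lookup-toSubset P i = trans (lookup∘tabulate _ i) (side (P i))
  where
  side : ∀ b → (if b then inside else outside) ≡ b
  side true  = refl
  side false = refl

∣toSubset∣≡count : ∀ {n} (P : Fin n → Bool) → ∣ toSubset P ∣ ≡ count P
∣toSubset∣≡count P = trans (∣∣≡count (toSubset P)) (count-cong (lookup-toSubset P))

degIn≡count : ∀ {n} (G : Graph n) (S : Subset n) u → degIn G S u ≡ count (λ v → lookup S v ∧ adj G u v)
degIn≡count G S u = trans (∣∣≡count (S ∩ toSubset (adj G u))) (count-cong λ v →
  trans (lookup-zipWith _∧_ v S (toSubset (adj G u))) (cong (lookup S v ∧_) (lookup-toSubset (adj G u) v)))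

sumFin≡sum : ∀ {n} (f : Fin n → ℕ) → sumFin f ≡ sum f
sumFin≡sum {zero}  f = refl
sumFin≡sum {suc n} f = cong (f zero +_) (sumFin≡sum (f ∘ suc))

4a≤4b+2⇒a≤b : ∀ a b → 2 * (2 * a) ≤ 2 * (2 * b) + 2 → a ≤ b
4a≤4b+2⇒a≤b a b 4a≤4b+2 with a ≤? b
... | yes a≤b = a≤b
... | no  a≰b = ⊥-elim (<⇒≱ 4b+2<4a 4a≤4b+2)
  where
  4b+2<4a : 2 * (2 * b) + 2 < 2 * (2 * a)
  4b+2<4a = begin-strict
    2 * (2 * b) + 2      <⟨ +-monoʳ-< (2 * (2 * b)) (s≤s (s≤s (s≤s z≤n))) ⟩
    2 * (2 * b) + 4      ≡⟨ 4b+4≡4[1+b] b ⟩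
    2 * (2 * suc b)      ≤⟨ *-monoʳ-≤ 2 (*-monoʳ-≤ 2 (≰⇒> a≰b)) ⟩
    2 * (2 * a)          ∎
    where
    open ≤-Reasoning
    4b+4≡4[1+b] : ∀ b → 2 * (2 * b) + 4 ≡ 2 * (2 * suc b)
    4b+4≡4[1+b] = solve-∀

telescope-step : ∀ {m e c r} j r′ g → m ≤ e + c → r ≡ r′ + e → j * m + r ≤ g + j * c →
                 suc j * m + r′ ≤ g + suc j * c
telescope-step {m} {e} {c} {r} j r′ g m≤e+c r≡r′+e invariant = begin
  suc j * m + r′              ≡⟨ +-assoc m (j * m) r′ ⟩
  m + (j * m + r′)            ≤⟨ +-monoˡ-≤ (j * m + r′) m≤e+c ⟩
  e + c + (j * m + r′)        ≡⟨ shuffle e c (j * m) r′ ⟩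
  c + (j * m + (r′ + e))      ≡⟨ cong (λ t → c + (j * m + t)) r≡r′+e ⟨
  c + (j * m + r)             ≤⟨ +-monoʳ-≤ c invariant ⟩
  c + (g + j * c)             ≡⟨ +-comm-middle c g (j * c) ⟩
  g + suc j * c               ∎
  where
  open ≤-Reasoning
  shuffle : ∀ e c x r′ → e + c + (x + r′) ≡ c + (x + (r′ + e))
  shuffle = solve-∀
  +-comm-middle : ∀ c g x → c + (g + x) ≡ g + (c + x)
  +-comm-middle = solve-∀

approximation-bound : ∀ k {s o c t m} → c + t ≡ s + o → 2 * c ≤ m → suc k * m ≤ k * s + suc k * (2 * o) →
                      (k + 2) * s ≤ 2 * (k + 1) * t
approximation-bound k {s} {o} {c} {t} {m} c+t≡s+o 2c≤m telescoped = +-cancelʳ-≤ X ((k + 2) * s) (2 * (k + 1) * t) (begin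
  (k + 2) * s + X                    ≡⟨ expand k s o ⟩
  2 * (k + 1) * (s + o)              ≡⟨ cong (2 * (k + 1) *_) c+t≡s+o ⟨
  2 * (k + 1) * (c + t)              ≡⟨ regroup k c t ⟩
  2 * (k + 1) * t + suc k * (2 * c)  ≤⟨ +-monoʳ-≤ (2 * (k + 1) * t) (≤-trans (*-monoʳ-≤ (suc k) 2c≤m) telescoped) ⟩
  2 * (k + 1) * t + X                ∎)
  where
  open ≤-Reasoning
  X = k * s + suc k * (2 * o)
  expand : ∀ k s o → (k + 2) * s + (k * s + suc k * (2 * o)) ≡ 2 * (k + 1) * (s + o)
  expand = solve-∀
  regroup : ∀ k c t → 2 * (k + 1) * (c + t) ≡ 2 * (k + 1) * t + suc k * (2 * c)
  regroup = solve-∀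

module _ {n : ℕ} where

  _⊆ʳ_ : Relation n → Relation n → Set
  A ⊆ʳ A′ = ∀ a b → A a b ≡ true → A′ a b ≡ true

  arcs-cong : {A A′ : Relation n} → (∀ a b → A a b ≡ A′ a b) → arcs A ≡ arcs A′
  arcs-cong A≗A′ = sum-cong-≗ (λ a → count-cong (A≗A′ a))

  arcs-mono : {A A′ : Relation n} → A ⊆ʳ A′ → arcs A ≤ arcs A′
  arcs-mono A⊆A′ = sum-mono-≤ (λ a → count-mono (A⊆A′ a))

  arcs-mono-< : {A A′ : Relation n} → A ⊆ʳ A′ → ∀ {u v} → A′ u v ≡ true → A u v ≡ false → arcs A < arcs A′
  arcs-mono-< A⊆A′ {u} {v} A′uv Auv = sum-mono-< (λ a → count-mono (A⊆A′ a)) u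
    (sum-mono-< (λ b → 𝟙-mono (A⊆A′ u b)) v (subst₂ (λ x y → 𝟙 x < 𝟙 y) (sym Auv) (sym A′uv) ≤-refl))

  arcs-false : {A : Relation n} → (∀ a b → A a b ≡ false) → arcs A ≡ 0
  arcs-false A≡f = sum-zero (λ a → count-false (A≡f a))

  arcs-transpose : (A : Relation n) → arcs A ≡ arcs (flip A)
  arcs-transpose A = ∑-comm (λ a b → 𝟙 (A a b))

  arcs-∨ : (A A′ : Relation n) →
           arcs (λ a b → A a b ∨ A′ a b) + arcs (λ a b → A a b ∧ A′ a b) ≡ arcs A + arcs A′
  arcs-∨ A A′ = begin
    arcs (λ a b → A a b ∨ A′ a b) + arcs (λ a b → A a b ∧ A′ a b)
      ≡⟨ ∑-distrib-+ (λ a → count (λ b → A a b ∨ A′ a b)) (λ a → count (λ b → A a b ∧ A′ a b)) ⟨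
    sum (λ a → count (λ b → A a b ∨ A′ a b) + count (λ b → A a b ∧ A′ a b))
      ≡⟨ sum-cong-≗ (λ a → count-∨ (A a) (A′ a)) ⟩
    sum (λ a → count (A a) + count (A′ a))
      ≡⟨ ∑-distrib-+ (degree A) (degree A′) ⟩
    arcs A + arcs A′ ∎
    where open ≡-Reasoning

  arcs-∨-≤ : (A A′ : Relation n) → arcs (λ a b → A a b ∨ A′ a b) ≤ arcs A + arcs A′
  arcs-∨-≤ A A′ = ≤-trans (m≤m+n _ _) (≤-reflexive (arcs-∨ A A′))

  arcs-∨-disjoint : (A A′ : Relation n) → (∀ a b → A a b ≡ true → A′ a b ≡ true → ⊥) →
                    arcs (λ a b → A a b ∨ A′ a b) ≡ arcs A + arcs A′
  arcs-∨-disjoint A A′ disjoint = begin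
    arcs A∨A′                                  ≡⟨ +-identityʳ (arcs A∨A′) ⟨
    arcs A∨A′ + 0                              ≡⟨ cong (arcs A∨A′ +_) (arcs-false never) ⟨
    arcs A∨A′ + arcs (λ a b → A a b ∧ A′ a b)  ≡⟨ arcs-∨ A A′ ⟩
    arcs A + arcs A′                           ∎
    where
    open ≡-Reasoning
    A∨A′ : Relation n
    A∨A′ a b = A a b ∨ A′ a b
    never : ∀ a b → (A a b ∧ A′ a b) ≡ false
    never a b with A a b in Aab | A′ a b in A′ab
    ... | true  | true  = ⊥-elim (disjoint a b Aab A′ab)
    ... | true  | false = refl
    ... | false | _     = refl

  arcs-≤-support : {A : Relation n} (P : Fin n → Bool) {d : ℕ} →
                   (∀ a b → A a b ≡ true → P a ≡ true) → (∀ a → P a ≡ true → degree A a ≤ d) →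
                   arcs A ≤ d * count P
  arcs-≤-support {A} P {d} support bounded = begin
    arcs A                    ≤⟨ sum-mono-≤ pointwise ⟩
    sum (λ a → d * 𝟙 (P a))   ≡⟨ *-distribˡ-sum d (𝟙 ∘ P) ⟨
    d * count P               ∎
    where
    open ≤-Reasoning
    pointwise : ∀ a → degree A a ≤ d * 𝟙 (P a)
    pointwise a with P a in Pa
    ... | true  = ≤-trans (bounded a Pa) (≤-reflexive (sym (*-identityʳ d)))
    ... | false = ≤-reflexive (trans (count-false noArcs) (sym (*-zeroʳ d)))
      where
      noArcs : ∀ b → A a b ≡ false
      noArcs b with A a b in Aab
      ... | true  = ⊥-elim (true≢false (support a b Aab) Pa)
      ... | false = refl

  arcs-point : (u v : Fin n) → arcs (λ a b → a == u ∧ b == v) ≡ 1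
  arcs-point u v = begin
    arcs (λ a b → a == u ∧ b == v)    ≡⟨ sum-cong-≗ row ⟩
    count (_== u)                     ≡⟨ count-singleton u ⟩
    1                                 ∎
    where
    open ≡-Reasoning
    row : ∀ a → count (λ b → a == u ∧ b == v) ≡ 𝟙 (a == u)
    row a with a == u
    ... | true  = count-singleton v
    ... | false = count-false {P = λ b → false ∧ b == v} (λ _ → refl)

  arcs-link : {u v : Fin n} → u ≢ v → arcs (link u v) ≡ 2
  arcs-link {u} {v} u≢v = begin
    arcs (link u v)          ≡⟨ arcs-∨-disjoint uv vu disjoint ⟩
    arcs uv + arcs vu        ≡⟨ cong₂ _+_ (arcs-point u v) (arcs-point v u) ⟩
    2                        ∎
    where
    open ≡-Reasoning
    uv vu : Relation n
    uv a b = a == u ∧ b == v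
    vu a b = a == v ∧ b == u
    disjoint : ∀ a b → uv a b ≡ true → vu a b ≡ true → ⊥
    disjoint a b a=u∧b=v a=v∧b=u =
      u≢v (trans (sym (==⇒≡ {a = a} (proj₁ (∧-true⁻ {a == u} a=u∧b=v)))) (==⇒≡ {a = a} (proj₁ (∧-true⁻ {a == v} a=v∧b=u))))

  -- Matchings and vertex covers

  _⊆ᴳ_ : Graph n → Graph n → Set
  H ⊆ᴳ G = adj H ⊆ʳ adj G

  IsVertexCover : Graph n → (Fin n → Bool) → Set
  IsVertexCover G C = ∀ a b → adj G a b ≡ true → (C a ∨ C b) ≡ true

  arcs-head≡arcs-tail : (G : Graph n) (P : Fin n → Bool) →
                        arcs (λ a b → adj G a b ∧ P b) ≡ arcs (λ a b → adj G a b ∧ P a)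
  arcs-head≡arcs-tail G P =
    trans (arcs-transpose (λ a b → adj G a b ∧ P b)) (arcs-cong (λ a b → cong (_∧ P a) (Graph.sym G b a)))

  arcs-≤-↾∁ : (G : Graph n) {d : ℕ} → (∀ a → degree (adj G) a ≤ d) → (C : Fin n → Bool) →
              arcs (adj G) ≤ arcs (adj G ↾ ∁ C) + 2 * (d * count C)
  arcs-≤-↾∁ G {d} deg≤d C = begin
    arcs (adj G)                                  ≡⟨ arcs-cong (λ a b → split (adj G a b) (C a) (C b)) ⟩
    arcs (λ a b → avoiding a b ∨ touching a b)     ≤⟨ arcs-∨-≤ avoiding touching ⟩
    arcs avoiding + arcs touching                  ≤⟨ +-monoʳ-≤ (arcs avoiding) (arcs-∨-≤ fromC toC) ⟩
    arcs avoiding + (arcs fromC + arcs toC)        ≡⟨ cong (λ t → arcs avoiding + (arcs fromC + t)) (arcs-head≡arcs-tail G C) ⟩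
    arcs avoiding + (arcs fromC + arcs fromC)      ≤⟨ +-monoʳ-≤ (arcs avoiding) (+-mono-≤ fromC≤ fromC≤) ⟩
    arcs avoiding + (d * count C + d * count C)    ≡⟨ cong (λ t → arcs avoiding + (d * count C + t)) (+-identityʳ _) ⟨
    arcs avoiding + 2 * (d * count C)              ∎
    where
    open ≤-Reasoning
    avoiding fromC toC touching : Relation n
    avoiding      = adj G ↾ ∁ C
    fromC    a b = adj G a b ∧ C a
    toC      a b = adj G a b ∧ C b
    touching a b = fromC a b ∨ toC a b
    split : ∀ m c c′ → m ≡ (m ∧ (not c ∧ not c′)) ∨ ((m ∧ c) ∨ (m ∧ c′))
    split false _     _     = refl
    split true  true  _     = refl
    split true  false true  = refl
    split true  false false = refl
    fromC≤ : arcs fromC ≤ d * count C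
    fromC≤ = arcs-≤-support C (λ a b → proj₂ ∘ ∧-true⁻)
      (λ a _ → ≤-trans (count-mono {P = fromC a} (λ b → proj₁ ∘ ∧-true⁻)) (deg≤d a))

  arcs-≤-cover : (G : Graph n) {d : ℕ} → (∀ a → degree (adj G) a ≤ d) →
                 {C : Fin n → Bool} → IsVertexCover G C → arcs (adj G) ≤ 2 * (d * count C)
  arcs-≤-cover G {d} deg≤d {C} cover = begin
    arcs (adj G)                             ≤⟨ arcs-≤-↾∁ G deg≤d C ⟩
    arcs (adj G ↾ ∁ C) + 2 * (d * count C)   ≡⟨ cong (_+ 2 * (d * count C)) (arcs-false uncovered) ⟩
    2 * (d * count C)                        ∎
    where
    open ≤-Reasoning
    uncovered : ∀ a b → (adj G ↾ ∁ C) a b ≡ false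
    uncovered a b with adj G a b in Gab
    ... | false = refl
    ... | true  with C a | C b | cover a b Gab
    ...            | true  | _    | _ = refl
    ...            | false | true | _ = refl

  handshake : (G : Graph n) → arcs (adj G) ≡ 2 * edgeCount G
  handshake G = begin
    arcs (adj G)                                   ≡⟨ arcs-cong split ⟩
    arcs (λ u v → forward u v ∨ forward v u)       ≡⟨ arcs-∨-disjoint forward (flip forward) disjoint ⟩
    arcs forward + arcs (flip forward)             ≡⟨ cong (arcs forward +_) (arcs-transpose forward) ⟨
    arcs forward + arcs forward                    ≡⟨ cong (arcs forward +_) (+-identityʳ (arcs forward)) ⟨
    2 * arcs forward                               ≡⟨ cong (2 *_) edges ⟨
    2 * edgeCount G                                ∎
    where
    open ≡-Reasoning
    forward : Relation n
    forward u v = ⌊ u <? v ⌋ ∧ adj G u v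
    split : ∀ u v → adj G u v ≡ (forward u v ∨ forward v u)
    split u v rewrite Graph.sym G v u with u <? v | v <? u
    ... | yes u<v | yes v<u = ⊥-elim (<-asym u<v v<u)
    ... | yes _   | no  _   = sym (∨-identityʳ (adj G u v))
    ... | no  _   | yes _   = refl
    ... | no  u≮v | no  v≮u with <-cmp u v
    ...   | tri< u<v _ _  = ⊥-elim (u≮v u<v)
    ...   | tri> _ _ v<u  = ⊥-elim (v≮u v<u)
    ...   | tri≈ _ refl _ = irrefl G u
    disjoint : ∀ u v → forward u v ≡ true → forward v u ≡ true → ⊥
    disjoint u v uv vu with u <? v | v <? u
    ... | yes u<v | yes v<u = <-asym u<v v<u
    edges : edgeCount G ≡ arcs forward
    edges = trans (sumFin≡sum (λ u → ∣ toSubset (forward u) ∣)) (sum-cong-≗ (λ u → ∣toSubset∣≡count (forward u)))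

  matching-degree≤1 : {G M : Graph n} → IsMatching G M → ∀ a → degree (adj M) a ≤ 1
  matching-degree≤1 {M = M} (_ , unique) a = count≤1 (adj M a) (unique a)

  matching-⊆ : {H G M : Graph n} → H ⊆ᴳ G → IsMatching H M → IsMatching G M
  matching-⊆ H⊆G (M⊆H , unique) = (λ a b → H⊆G a b ∘ M⊆H a b) , unique

  weak-duality : {G M : Graph n} {C : Fin n → Bool} →
                 IsMatching G M → IsVertexCover M C → arcs (adj M) ≤ 2 * count C
  weak-duality {G} {M} {C} isM cover =
    subst (λ c → arcs (adj M) ≤ 2 * c) (*-identityˡ (count C))
      (arcs-≤-cover M (matching-degree≤1 {G} {M} isM) cover)

  induced : Graph n → (Fin n → Bool) → Graph n
  induced G P = record
    { adj    = adj G ↾ P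
    ; sym    = λ a b → cong₂ _∧_ (Graph.sym G a b) (∧-comm (P a) (P b))
    ; irrefl = λ a → cong (_∧ (P a ∧ P a)) (irrefl G a)
    }

  removeVertex : Graph n → Fin n → Graph n
  removeVertex G x = induced G (∁ (_== x))

  singleEdge : (u v : Fin n) → u ≢ v → Graph n
  singleEdge u v u≢v = record
    { adj    = link u v
    ; sym    = λ a b → trans (∨-comm (a == u ∧ b == v) (a == v ∧ b == u))
                             (cong₂ _∨_ (∧-comm (a == v) (b == u)) (∧-comm (a == u) (b == v)))
    ; irrefl = loopless
    }
    where
    loopless : ∀ a → link u v a a ≡ false
    loopless a with a ≟ u | a ≟ v
    ... | yes refl | yes refl = ⊥-elim (u≢v refl)
    ... | yes _    | no  _    = refl
    ... | no  _    | yes _    = refl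
    ... | no  _    | no  _    = refl

  removeEdge : (G : Graph n) (u v : Fin n) → u ≢ v → Graph n
  removeEdge G u v u≢v = deleteEdges G (singleEdge u v u≢v)

  _∪ᴳ_ : Graph n → Graph n → Graph n
  G ∪ᴳ H = record
    { adj    = λ a b → adj G a b ∨ adj H a b
    ; sym    = λ a b → cong₂ _∨_ (Graph.sym G a b) (Graph.sym H a b)
    ; irrefl = λ a → cong₂ _∨_ (irrefl G a) (irrefl H a)
    }

  emptyGraph : Graph n
  emptyGraph = record { adj = λ _ _ → false ; sym = λ _ _ → refl ; irrefl = λ _ → refl }

  induced-⊆ : (G : Graph n) (P : Fin n → Bool) → induced G P ⊆ᴳ G
  induced-⊆ G P a b = proj₁ ∘ ∧-true⁻

  deleteEdges-⊆ : (G M : Graph n) → deleteEdges G M ⊆ᴳ G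
  deleteEdges-⊆ G M a b = proj₁ ∘ ∧-true⁻

  removeEdge-⊆ : (G : Graph n) (u v : Fin n) (u≢v : u ≢ v) → removeEdge G u v u≢v ⊆ᴳ G
  removeEdge-⊆ G u v u≢v = deleteEdges-⊆ G (singleEdge u v u≢v)

  removeVertex-loses : (G : Graph n) (u x : Fin n) → adj (removeVertex G x) u x ≡ false
  removeVertex-loses G u x rewrite ==-refl x =
    trans (cong (adj G u x ∧_) (∧-zeroʳ (not (u == x)))) (∧-zeroʳ (adj G u x))

  removeEdge-loses : (G : Graph n) (u v : Fin n) (u≢v : u ≢ v) → adj (removeEdge G u v u≢v) u v ≡ false
  removeEdge-loses G u v u≢v rewrite ==-refl u | ==-refl v = ∧-zeroʳ (adj G u v)

  removeVertex-keeps : (G : Graph n) {x a b : Fin n} → adj G a b ≡ true → a ≢ x → b ≢ x →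
                       adj (removeVertex G x) a b ≡ true
  removeVertex-keeps G Gab a≢x b≢x rewrite Gab | ==-≢ a≢x | ==-≢ b≢x = refl

  removeEdge-keeps : (G : Graph n) {u v : Fin n} (u≢v : u ≢ v) {a b : Fin n} →
                     adj G a b ≡ true → link u v a b ≡ false → adj (removeEdge G u v u≢v) a b ≡ true
  removeEdge-keeps G u≢v Gab ¬uv rewrite Gab | ¬uv = refl

  removeVertex⁻ : (G : Graph n) {x a b : Fin n} → adj (removeVertex G x) a b ≡ true →
                  adj G a b ≡ true × a ≢ x × b ≢ x
  removeVertex⁻ G {x} {a} {b} Gab with ∧-true⁻ {adj G a b} Gab
  ... | Gab′ , a,b≠x with ∧-true⁻ {not (a == x)} a,b≠x
  ...   | a≠x , b≠x = Gab′ , avoid a≠x , avoid b≠x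
    where
    avoid : ∀ {c} → not (c == x) ≡ true → c ≢ x
    avoid c≠x refl = true≢false (==-refl x) (trans (sym (not-involutive (x == x))) (cong not c≠x))

  link⁻ : ∀ {u v a b : Fin n} → link u v a b ≡ true → (a ≡ u × b ≡ v) ⊎ (a ≡ v × b ≡ u)
  link⁻ {u} {v} {a} {b} uvab with ∨-true⁻ {a == u ∧ b == v} uvab
  ... | inj₁ a=u∧b=v = inj₁ (==⇒≡ (proj₁ (∧-true⁻ a=u∧b=v)) , ==⇒≡ (proj₂ (∧-true⁻ {a == u} a=u∧b=v)))
  ... | inj₂ a=v∧b=u = inj₂ (==⇒≡ (proj₁ (∧-true⁻ a=v∧b=u)) , ==⇒≡ (proj₂ (∧-true⁻ {a == v} a=v∧b=u)))

  link-⊆ : {G : Graph n} {u v : Fin n} → adj G u v ≡ true → ∀ a b → link u v a b ≡ true → adj G a b ≡ true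
  link-⊆ {G} {u} {v} Guv a b uvab with link⁻ {u = u} {v = v} {a = a} {b = b} uvab
  ... | inj₁ (refl , refl) = Guv
  ... | inj₂ (refl , refl) = trans (Graph.sym G a b) Guv

  link-partner : {u v a b c : Fin n} → u ≢ v → link u v a b ≡ true → link u v a c ≡ true → b ≡ c
  link-partner {u} {v} {a} {b} {c} u≢v ab ac
    with link⁻ {u = u} {v = v} {a = a} {b = b} ab | link⁻ {u = u} {v = v} {a = a} {b = c} ac
  ... | inj₁ (_ , refl)    | inj₁ (_ , refl)   = refl
  ... | inj₂ (_ , refl)    | inj₂ (_ , refl)   = refl
  ... | inj₁ (refl , _)    | inj₂ (a≡v , _)    = ⊥-elim (u≢v a≡v)
  ... | inj₂ (refl , _)    | inj₁ (a≡u , _)    = ⊥-elim (u≢v (sym a≡u))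

  irrefl-≢ : (G : Graph n) {u v : Fin n} → adj G u v ≡ true → u ≢ v
  irrefl-≢ G {u} Guv refl = true≢false Guv (irrefl G u)

  matching-insertEdge : {G N : Graph n} {u v : Fin n} → adj G u v ≡ true → (u≢v : u ≢ v) →
                        IsMatching G N → (∀ a b → adj N a b ≡ true → a ≢ u × a ≢ v) →
                        IsMatching G (N ∪ᴳ singleEdge u v u≢v)
  matching-insertEdge {G} {N} {u} {v} Guv u≢v (N⊆G , unique) avoids = N+uv⊆G , unique′
    where
    N+uv⊆G : ∀ a b → (adj N a b ∨ link u v a b) ≡ true → adj G a b ≡ true
    N+uv⊆G a b Nab∨uvab with ∨-true⁻ {adj N a b} Nab∨uvab
    ... | inj₁ Nab  = N⊆G a b Nab
    ... | inj₂ uvab = link-⊆ {G} Guv a b uvab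
    endpoint : ∀ {a b c} → adj N a b ≡ true → link u v a c ≡ true → ⊥
    endpoint {a} {b} {c} Nab uvac with link⁻ {u = u} {v = v} {a = a} {b = c} uvac | avoids a b Nab
    ... | inj₁ (a≡u , _) | a≢u , _ = a≢u a≡u
    ... | inj₂ (a≡v , _) | _ , a≢v = a≢v a≡v
    unique′ : ∀ a b c → (adj N a b ∨ link u v a b) ≡ true → (adj N a c ∨ link u v a c) ≡ true → b ≡ c
    unique′ a b c ab ac with ∨-true⁻ {adj N a b} ab | ∨-true⁻ {adj N a c} ac
    ... | inj₁ Nab  | inj₁ Nac  = unique a b c Nab Nac
    ... | inj₁ Nab  | inj₂ uvac = ⊥-elim (endpoint {c = c} Nab uvac)
    ... | inj₂ uvab | inj₁ Nac  = ⊥-elim (endpoint {c = b} Nac uvab)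
    ... | inj₂ uvab | inj₂ uvac = link-partner {a = a} {b = b} {c = c} u≢v uvab uvac

  cover-insert : {G : Graph n} {C : Fin n → Bool} (x : Fin n) →
                 IsVertexCover (removeVertex G x) C → IsVertexCover G (λ a → C a ∨ a == x)
  cover-insert {G} {C} x cover a b Gab with a ≟ x | b ≟ x
  ... | yes _   | _       = ∨-trueˡ _ (∨-zeroʳ (C a))
  ... | no _    | yes _   = ∨-trueʳ (C a ∨ false) (∨-zeroʳ (C b))
  ... | no a≢x  | no b≢x  =
    ∨-true-mono {C a} {C b} (∨-trueˡ false) (∨-trueˡ false) (cover a b (removeVertex-keeps G Gab a≢x b≢x))

  cover-removeEdge : {G : Graph n} {u v : Fin n} {u≢v : u ≢ v} {C : Fin n → Bool} →
                     IsVertexCover (removeEdge G u v u≢v) C → C u ≡ true → IsVertexCover G C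
  cover-removeEdge {G} {u} {v} {u≢v} {C} cover Cu a b Gab with link u v a b in uvab
  ... | false = cover a b (removeEdge-keeps G u≢v Gab uvab)
  ... | true  with link⁻ {u = u} {v = v} {a = a} {b = b} uvab
  ...           | inj₁ (refl , _) = ∨-trueˡ (C b) Cu
  ...           | inj₂ (_ , refl) = ∨-trueʳ (C a) Cu

  -- Kőnig's theorem

  IsProperColouring : Graph n → (Fin n → Bool) → Set
  IsProperColouring G c = ∀ a b → adj G a b ≡ true → c a ≢ c b

  record KőnigPair (G : Graph n) : Set where
    field
      matching       : Graph n
      cover          : Fin n → Bool
      isMatching     : IsMatching G matching
      isCover        : IsVertexCover G cover
      cover≤matching : 2 * count cover ≤ arcs (adj matching)

  extendByVertex : (G : Graph n) (x : Fin n) (K : KőnigPair (removeVertex G x)) (N : Graph n) →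
                   IsMatching G N → arcs (adj (KőnigPair.matching K)) + 2 ≤ arcs (adj N) → KőnigPair G
  extendByVertex G x K N N-matches grows = record
    { matching       = N
    ; cover          = λ a → cover a ∨ a == x
    ; isMatching     = N-matches
    ; isCover        = cover-insert {G} {cover} x isCover
    ; cover≤matching = begin
        2 * count (λ a → cover a ∨ a == x)   ≤⟨ *-monoʳ-≤ 2 (count-insert cover x) ⟩
        2 * (count cover + 1)                ≡⟨ *-distribˡ-+ 2 (count cover) 1 ⟩
        2 * count cover + 2                  ≤⟨ +-monoˡ-≤ 2 cover≤matching ⟩
        arcs (adj matching) + 2              ≤⟨ grows ⟩
        arcs (adj N)                         ∎
    }
    where
    open KőnigPair K
    open ≤-Reasoning

  leaf-step : (G : Graph n) {u v : Fin n} → adj G u v ≡ true → (∀ w → adj G u w ≡ true → w ≡ v) →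
              KőnigPair (removeVertex G v) → KőnigPair G
  leaf-step G {u} {v} Guv leaf K =
    extendByVertex G v K (N₁ ∪ᴳ singleEdge u v u≢v)
      (matching-insertEdge {G} {N₁} Guv u≢v N₁-matchesG avoids)
      (≤-reflexive (sym grows))
    where
    open KőnigPair K renaming (matching to N₁)
    u≢v = irrefl-≢ G Guv
    N₁-matchesG : IsMatching G N₁
    N₁-matchesG = matching-⊆ {H = removeVertex G v} {G = G} {M = N₁} (induced-⊆ G (∁ (_== v))) isMatching
    avoids : ∀ a b → adj N₁ a b ≡ true → a ≢ u × a ≢ v
    avoids a b N₁ab with removeVertex⁻ G (proj₁ isMatching a b N₁ab)
    ... | Gab , a≢v , b≢v = (λ { refl → b≢v (leaf b Gab) }) , a≢v
    grows : arcs (λ a b → adj N₁ a b ∨ link u v a b) ≡ arcs (adj N₁) + 2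
    grows = trans (arcs-∨-disjoint (adj N₁) (link u v) disjoint) (cong (arcs (adj N₁) +_) (arcs-link u≢v))
      where
      disjoint : ∀ a b → adj N₁ a b ≡ true → link u v a b ≡ true → ⊥
      disjoint a b N₁ab uvab with link⁻ {u = u} {v = v} {a = a} {b = b} uvab | avoids a b N₁ab
      ... | inj₁ (a≡u , _) | a≢u , _ = a≢u a≡u
      ... | inj₂ (a≡v , _) | _ , a≢v = a≢v a≡v

  matching-removeEdge : {G M : Graph n} {u v : Fin n} {u≢v : u ≢ v} →
                        IsMatching (removeEdge G u v u≢v) M → IsMatching G M
  matching-removeEdge {G} {M} {u} {v} {u≢v} =
    matching-⊆ {H = removeEdge G u v u≢v} {G = G} {M = M} (removeEdge-⊆ G u v u≢v)

  cover-removeVertex : (G : Graph n) {u x y : Fin n} {u≢y : u ≢ y} {C : Fin n → Bool} {N : Graph n} →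
                       IsVertexCover (removeEdge G u y u≢y) C → N ⊆ᴳ removeVertex G x → adj N u y ≡ false →
                       IsVertexCover N (λ a → C a ∧ not (a == x))
  cover-removeVertex G {u} {x} {y} {u≢y} {C} {N} cover N⊆G-x Nuy a b Nab with removeVertex⁻ G (N⊆G-x a b Nab)
  ... | Gab , a≢x , b≢x rewrite ==-≢ a≢x | ==-≢ b≢x | ∧-identityʳ (C a) | ∧-identityʳ (C b) =
    cover a b (removeEdge-keeps G u≢y Gab ab∉uy)
    where
    ab∉uy : link u y a b ≡ false
    ab∉uy with link u y a b in uyab
    ... | false = refl
    ... | true with link⁻ {u = u} {v = y} {a = a} {b = b} uyab
    ...          | inj₁ (refl , refl) = ⊥-elim (true≢false Nab Nuy)
    ...          | inj₂ (refl , refl) = ⊥-elim (true≢false (trans (Graph.sym N b a) Nab) Nuy)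

  -- Either ν(G − uy) exceeds ν(G − x), and the cover of G − x extended by x is small enough, or
  -- the cover C₂ of G − uy contains u: otherwise it contains x, and C₂ − x would cover the
  -- matching of G − x, which avoids uy, contradicting the sizes.
  rizzi-step : (G : Graph n) {u x y : Fin n} (Gux : adj G u x ≡ true) (Guy : adj G u y ≡ true) → x ≢ y →
               (K₁ : KőnigPair (removeVertex G x)) → adj (KőnigPair.matching K₁) u y ≡ false →
               KőnigPair (removeEdge G u y (irrefl-≢ G Guy)) → KőnigPair G
  rizzi-step G {u} {x} {y} Gux Guy x≢y K₁ N₁uy K₂
    with arcs (adj (KőnigPair.matching K₁)) + 2 ≤? arcs (adj (KőnigPair.matching K₂))
  ... | yes grows = extendByVertex G x K₁ N₂ N₂-matchesG grows
    where
    open KőnigPair K₂ renaming (matching to N₂; isMatching to isMatching₂)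
    N₂-matchesG = matching-removeEdge {G = G} {M = N₂} {u≢v = irrefl-≢ G Guy} isMatching₂
  ... | no ¬grows = record
    { matching       = N₂
    ; cover          = C₂
    ; isMatching     = matching-removeEdge {G = G} {M = N₂} {u≢v = u≢y} isMatching₂
    ; isCover        = cover-removeEdge {G = G} {u≢v = u≢y} {C = C₂} isCover₂ C₂u
    ; cover≤matching = cover≤matching₂
    }
    where
    open KőnigPair K₁ renaming (matching to N₁; isMatching to isMatching₁)
    open KőnigPair K₂ renaming (matching to N₂; cover to C₂; isMatching to isMatching₂;
                                 isCover to isCover₂; cover≤matching to cover≤matching₂)
    u≢y = irrefl-≢ G Guy
    ux∉uy : link u y u x ≡ false
    ux∉uy rewrite ==-refl u | ==-≢ x≢y | ==-≢ u≢y = refl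
    C₂u : C₂ u ≡ true
    C₂u with ∨-true⁻ {C₂ u} (isCover₂ u x (removeEdge-keeps G u≢y Gux ux∉uy))
    ... | inj₁ C₂u = C₂u
    ... | inj₂ C₂x = ⊥-elim (¬grows (begin
      arcs (adj N₁) + 2                    ≤⟨ +-monoˡ-≤ 2 N₁≤C₂-x ⟩
      2 * count C₂-x + 2                   ≡⟨ *-distribˡ-+ 2 (count C₂-x) 1 ⟨
      2 * (count C₂-x + 1)                 ≤⟨ *-monoʳ-≤ 2 (count-remove C₂ C₂x) ⟩
      2 * count C₂                         ≤⟨ cover≤matching₂ ⟩
      arcs (adj N₂)                        ∎))
      where
      open ≤-Reasoning
      C₂-x = λ a → C₂ a ∧ not (a == x)
      N₁≤C₂-x : arcs (adj N₁) ≤ 2 * count C₂-x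
      N₁≤C₂-x = weak-duality {G = removeVertex G x} {M = N₁} isMatching₁
        (cover-removeVertex G {x = x} {u≢y = u≢y} {C = C₂} {N = N₁} isCover₂ (proj₁ isMatching₁) N₁uy)

  OtherNeighbour : Graph n → Fin n → Fin n → Set
  OtherNeighbour G a b = ∃ λ w → adj G a w ≡ true × w ≢ b

  otherNeighbour? : (G : Graph n) (a b : Fin n) → Dec (OtherNeighbour G a b)
  otherNeighbour? G a b = any? λ w → (adj G a w Bool.≟ true) ×-dec ¬? (w ≟ b)

  nonIsolated : Graph n → Fin n → Bool
  nonIsolated G a = does (any? λ b → adj G a b Bool.≟ true)

  colourClass : Graph n → (Fin n → Bool) → Fin n → Bool
  colourClass G c a = c a ∧ nonIsolated G a

  colourClass-cover : (G : Graph n) {c : Fin n → Bool} → IsProperColouring G c →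
                      IsVertexCover G (colourClass G c)
  colourClass-cover G {c} proper a b Gab with c a in ca | c b in cb
  ... | true  | _     = ∨-trueˡ _ (dec-true (any? λ b → adj G a b Bool.≟ true) (b , Gab))
  ... | false | true  = ∨-trueʳ false (dec-true (any? λ a → adj G b a Bool.≟ true) (a , trans (Graph.sym G b a) Gab))
  ... | false | false = ⊥-elim (proper a b Gab (trans ca (sym cb)))

  colourClass-arcs : (G : Graph n) {c : Fin n → Bool} → IsProperColouring G c →
                     (∀ a b → adj G a b ≡ true → OtherNeighbour G a b) →
                     2 * (2 * count (colourClass G c)) ≤ arcs (adj G)
  colourClass-arcs G {c} proper other = begin
    2 * (2 * count (colourClass G c))                  ≤⟨ *-monoʳ-≤ 2 C≤fromc ⟩
    2 * arcs fromc                                     ≡⟨ cong (arcs fromc +_) (+-identityʳ (arcs fromc)) ⟩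
    arcs fromc + arcs fromc                            ≡⟨ cong (arcs fromc +_) (arcs-head≡arcs-tail G c) ⟨
    arcs fromc + arcs toc                              ≡⟨ arcs-∨-disjoint fromc toc bichromatic ⟨
    arcs (λ a b → fromc a b ∨ toc a b)                 ≤⟨ arcs-mono (λ a b → [ proj₁ ∘ ∧-true⁻ , proj₁ ∘ ∧-true⁻ ]′ ∘ ∨-true⁻) ⟩
    arcs (adj G)                                       ∎
    where
    open ≤-Reasoning
    fromc toc : Relation n
    fromc a b = adj G a b ∧ c a
    toc   a b = adj G a b ∧ c b
    bichromatic : ∀ a b → fromc a b ≡ true → toc a b ≡ true → ⊥
    bichromatic a b Gab∧ca Gab∧cb with ∧-true⁻ {adj G a b} Gab∧ca | ∧-true⁻ {adj G a b} Gab∧cb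
    ... | Gab , ca | _ , cb = proper a b Gab (trans ca (sym cb))
    degree≥2 : ∀ a → 2 * 𝟙 (colourClass G c a) ≤ degree fromc a
    degree≥2 a with c a in ca | any? (λ b → adj G a b Bool.≟ true)
    ... | false | _             = z≤n
    ... | true  | no _          = z≤n
    ... | true  | yes (b , Gab) with other a b Gab
    ...   | w , Gaw , w≢b =
      count≥2 (λ b → adj G a b ∧ true) (trans (∧-identityʳ _) Gaw) (trans (∧-identityʳ _) Gab) w≢b
    C≤fromc : 2 * count (colourClass G c) ≤ arcs fromc
    C≤fromc = ≤-trans (≤-reflexive (*-distribˡ-sum 2 (𝟙 ∘ colourClass G c))) (sum-mono-≤ degree≥2)

  arcs-≤-removeEdge : (G : Graph n) {u v : Fin n} (u≢v : u ≢ v) →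
                      arcs (adj G) ≤ arcs (adj (removeEdge G u v u≢v)) + 2
  arcs-≤-removeEdge G {u} {v} u≢v = begin
    arcs (adj G)                                ≤⟨ arcs-mono split ⟩
    arcs (λ a b → adj G′ a b ∨ link u v a b)    ≤⟨ arcs-∨-≤ (adj G′) (link u v) ⟩
    arcs (adj G′) + arcs (link u v)             ≡⟨ cong (arcs (adj G′) +_) (arcs-link u≢v) ⟩
    arcs (adj G′) + 2                           ∎
    where
    open ≤-Reasoning
    G′ = removeEdge G u v u≢v
    split : ∀ a b → adj G a b ≡ true → (adj G′ a b ∨ link u v a b) ≡ true
    split a b Gab with link u v a b
    ... | false = ∨-trueˡ false (trans (∧-identityʳ (adj G a b)) Gab)
    ... | true  = ∨-zeroʳ (adj G a b ∧ false)

  cycle-step : (G : Graph n) {c : Fin n → Bool} → IsProperColouring G c →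
               (∀ a → degree (adj G) a ≤ 2) → (∀ a b → adj G a b ≡ true → OtherNeighbour G a b) →
               {u v : Fin n} (Guv : adj G u v ≡ true) →
               KőnigPair (removeEdge G u v (irrefl-≢ G Guv)) → KőnigPair G
  cycle-step G {c} proper deg≤2 other {u} {v} Guv K′ = record
    { matching       = N′
    ; cover          = colourClass G c
    ; isMatching     = matching-removeEdge {G = G} {M = N′} {u≢v = u≢v} isMatching′
    ; isCover        = colourClass-cover G proper
    ; cover≤matching = ≤-trans (*-monoʳ-≤ 2 C≤C′) cover≤matching′
    }
    where
    open KőnigPair K′ renaming (matching to N′; cover to C′; isMatching to isMatching′;
                                 isCover to isCover′; cover≤matching to cover≤matching′)
    u≢v = irrefl-≢ G Guv
    G′ = removeEdge G u v u≢v
    C≤C′ : count (colourClass G c) ≤ count C′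
    C≤C′ = 4a≤4b+2⇒a≤b _ _ (begin
      2 * (2 * count (colourClass G c))   ≤⟨ colourClass-arcs G proper other ⟩
      arcs (adj G)                        ≤⟨ arcs-≤-removeEdge G u≢v ⟩
      arcs (adj G′) + 2                   ≤⟨ +-monoˡ-≤ 2 (arcs-≤-cover G′ deg′≤2 isCover′) ⟩
      2 * (2 * count C′) + 2              ∎)
      where
      open ≤-Reasoning
      deg′≤2 : ∀ a → degree (adj G′) a ≤ 2
      deg′≤2 a = ≤-trans (count-mono (removeEdge-⊆ G u v u≢v a)) (deg≤2 a)

  Branching : Graph n → Set
  Branching G = ∃ λ u → ∃ λ x → ∃ λ y → ∃ λ z →
    (adj G u x ≡ true × adj G u y ≡ true × adj G u z ≡ true) × (x ≢ y × x ≢ z × y ≢ z)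

  branching? : (G : Graph n) → Dec (Branching G)
  branching? G = any? λ u → any? λ x → any? λ y → any? λ z →
    (adj G u x Bool.≟ true ×-dec adj G u y Bool.≟ true ×-dec adj G u z Bool.≟ true) ×-dec
    (¬? (x ≟ y) ×-dec ¬? (x ≟ z) ×-dec ¬? (y ≟ z))

  Leaf : Graph n → Set
  Leaf G = ∃ λ u → ∃ λ v → adj G u v ≡ true × ¬ OtherNeighbour G u v

  leaf? : (G : Graph n) → Dec (Leaf G)
  leaf? G = any? λ u → any? λ v → adj G u v Bool.≟ true ×-dec ¬? (otherNeighbour? G u v)

  HasEdge : Graph n → Set
  HasEdge G = ∃ λ u → ∃ λ v → adj G u v ≡ true

  hasEdge? : (G : Graph n) → Dec (HasEdge G)
  hasEdge? G = any? λ u → any? λ v → adj G u v Bool.≟ true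

  edgeless-step : (G : Graph n) → ¬ HasEdge G → KőnigPair G
  edgeless-step G ¬edge = record
    { matching       = emptyGraph
    ; cover          = λ _ → false
    ; isMatching     = (λ _ _ ()) , (λ _ _ _ ())
    ; isCover        = λ a b Gab → ⊥-elim (¬edge (a , b , Gab))
    ; cover≤matching = subst (λ k → 2 * k ≤ arcs (adj emptyGraph)) (sym (count-false {n} {λ _ → false} (λ _ → refl)))
                             z≤n
    }

  ¬branching⇒degree≤2 : (G : Graph n) → ¬ Branching G → ∀ a → degree (adj G) a ≤ 2
  ¬branching⇒degree≤2 G ¬branching a = count≤2 (adj G a) λ {x} {y} {z} Gax Gay Gaz x≢y x≢z y≢z →
    ¬branching (a , x , y , z , (Gax , Gay , Gaz) , (x≢y , x≢z , y≢z))

  ¬leaf⇒otherNeighbour : (G : Graph n) → ¬ Leaf G → ∀ a b → adj G a b ≡ true → OtherNeighbour G a b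
  ¬leaf⇒otherNeighbour G ¬leaf a b Gab =
    decidable-stable (otherNeighbour? G a b) (λ ¬other → ¬leaf (a , b , Gab , ¬other))

  leaf⇒unique : (G : Graph n) {u v : Fin n} → ¬ OtherNeighbour G u v → ∀ w → adj G u w ≡ true → w ≡ v
  leaf⇒unique G {v = v} ¬other w Guw = decidable-stable (w ≟ v) (λ w≢v → ¬other (w , Guw , w≢v))

  -- Rizzi's induction on the number of edges: use a vertex with three neighbours, else a vertex of
  -- degree one, else every non-isolated vertex has degree two and G is a union of even cycles.
  kőnig-< : ∀ m (G : Graph n) {c : Fin n → Bool} → IsProperColouring G c → arcs (adj G) < m → KőnigPair G
  kőnig-< zero    G proper ()
  kőnig-< (suc m) G {c} proper arcs≤m = step (branching? G) (leaf? G) (hasEdge? G)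
    where
    recurse : (H : Graph n) → H ⊆ᴳ G → ∀ {a b} → adj G a b ≡ true → adj H a b ≡ false → KőnigPair H
    recurse H H⊆G Gab Hab =
      kőnig-< m H (λ a b → proper a b ∘ H⊆G a b) (<-≤-trans (arcs-mono-< H⊆G Gab Hab) (≤-pred arcs≤m))
    withoutVertex : ∀ {u} x → adj G u x ≡ true → KőnigPair (removeVertex G x)
    withoutVertex {u} x Gux = recurse (removeVertex G x) (induced-⊆ G (∁ (_== x))) Gux (removeVertex-loses G u x)
    withoutEdge : ∀ {u v} (Guv : adj G u v ≡ true) → KőnigPair (removeEdge G u v (irrefl-≢ G Guv))
    withoutEdge {u} {v} Guv =
      recurse (removeEdge G u v u≢v) (removeEdge-⊆ G u v u≢v) Guv (removeEdge-loses G u v u≢v)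
      where u≢v = irrefl-≢ G Guv
    step : Dec (Branching G) → Dec (Leaf G) → Dec (HasEdge G) → KőnigPair G
    step (yes (u , x , y , z , (Gux , Guy , Guz) , (x≢y , x≢z , y≢z))) _ _
      with withoutVertex x Gux
    ... | K₁ with adj (KőnigPair.matching K₁) u y in N₁uy | adj (KőnigPair.matching K₁) u z in N₁uz
    ...   | false | _     = rizzi-step G Gux Guy x≢y K₁ N₁uy (withoutEdge Guy)
    ...   | true  | false = rizzi-step G Gux Guz x≢z K₁ N₁uz (withoutEdge Guz)
    ...   | true  | true  = ⊥-elim (y≢z (proj₂ (KőnigPair.isMatching K₁) u y z N₁uy N₁uz))
    step (no _) (yes (u , v , Guv , ¬other)) _ =
      leaf-step G Guv (leaf⇒unique G ¬other) (withoutVertex v Guv)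
    step (no ¬branching) (no ¬leaf) (yes (u , v , Guv)) =
      cycle-step G proper (¬branching⇒degree≤2 G ¬branching) (¬leaf⇒otherNeighbour G ¬leaf) Guv (withoutEdge Guv)
    step (no _) (no _) (no ¬edge) = edgeless-step G ¬edge

  bipartite-⊆ : {H G : Graph n} → H ⊆ᴳ G → IsBipartite G → IsBipartite H
  bipartite-⊆ H⊆G (c , proper) = c , λ a b → proper a b ∘ H⊆G a b

  kőnig : (G : Graph n) → IsBipartite G → KőnigPair G
  kőnig G (c , proper) = kőnig-< (suc (arcs (adj G))) G proper ≤-refl

  -- Deleting maximum matchings

  ∈toSubset-∁ : {C : Fin n → Bool} {w : Fin n} → w ∈ toSubset (∁ C) → C w ≡ false
  ∈toSubset-∁ {C} {w} w∈ =
    trans (sym (not-involutive (C w))) (cong not (trans (sym (lookup-toSubset (∁ C) w)) ([]=⇒lookup w∈)))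

  cover-complement-independent : {G : Graph n} {C : Fin n → Bool} → IsVertexCover G C →
                                 IsIndependent G (toSubset (∁ C))
  cover-complement-independent {G} {C} cover u v u∉C v∉C with adj G u v in Guv
  ... | false = refl
  ... | true  with ∨-true⁻ {C u} (cover u v Guv)
  ...   | inj₁ Cu = ⊥-elim (true≢false Cu (∈toSubset-∁ {C} u∉C))
  ...   | inj₂ Cv = ⊥-elim (true≢false Cv (∈toSubset-∁ {C} v∉C))

  arcs-↾-mono : {H G : Graph n} → H ⊆ᴳ G → (S : Fin n → Bool) → arcs (adj H ↾ S) ≤ arcs (adj G ↾ S)
  arcs-↾-mono H⊆G S = arcs-mono (λ a b → ∧-true-monoˡ (H⊆G a b))

  arcs-↾-deleteEdges : (H M : Graph n) → M ⊆ᴳ H → (S : Fin n → Bool) →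
                       arcs (adj H ↾ S) ≡ arcs (adj (deleteEdges H M) ↾ S) + arcs (adj M ↾ S)
  arcs-↾-deleteEdges H M M⊆H S =
    trans (arcs-cong (λ a b → split (adj H a b) (adj M a b) (S a ∧ S b) (M⊆H a b)))
          (arcs-∨-disjoint (adj (deleteEdges H M) ↾ S) (adj M ↾ S) disjoint)
    where
    split : ∀ h m t → (m ≡ true → h ≡ true) → h ∧ t ≡ ((h ∧ not m) ∧ t) ∨ (m ∧ t)
    split h     true  t m⇒h rewrite m⇒h refl = refl
    split true  false t _   = sym (∨-identityʳ t)
    split false false t _   = refl
    disjoint : ∀ a b → (adj (deleteEdges H M) ↾ S) a b ≡ true → (adj M ↾ S) a b ≡ true → ⊥
    disjoint a b H∖Mab Mab = true≢false (proj₁ (∧-true⁻ Mab))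
      (trans (sym (not-involutive (adj M a b))) (cong not (proj₂ (∧-true⁻ {adj H a b} (proj₁ (∧-true⁻ H∖Mab))))))

  matching-arcs≤ : {G M : Graph n} → IsMatching G M → (S : Fin n → Bool) →
                   arcs (adj M) ≤ arcs (adj M ↾ S) + 2 * count (∁ S)
  matching-arcs≤ {G} {M} isM S = subst₂ (λ x y → arcs (adj M) ≤ x + 2 * y)
    (arcs-cong (λ a b → cong₂ (λ p q → adj M a b ∧ (p ∧ q)) (not-involutive (S a)) (not-involutive (S b))))
    (*-identityˡ (count (∁ S)))
    (arcs-≤-↾∁ M (matching-degree≤1 {G = G} {M = M} isM) (∁ S))

  maxMatching-arcs : {H M N : Graph n} → IsMaxMatching H M → IsMatching H N → arcs (adj N) ≤ arcs (adj M)
  maxMatching-arcs {M = M} {N} (_ , maximal) isN =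
    subst₂ _≤_ (sym (handshake N)) (sym (handshake M)) (*-monoʳ-≤ 2 (maximal N isN))

  kDependent-arcs : (k : ℕ) (G : Graph n) (S : Subset n) → IsKDependent k G S →
                    arcs (adj G ↾ lookup S) ≤ k * count (lookup S)
  kDependent-arcs k G S kdep = arcs-≤-support (lookup S) (λ a b → proj₁ ∘ ∧-true⁻ ∘ proj₂ ∘ ∧-true⁻ {adj G a b})
    λ a Sa → subst (_≤ k) (trans (degIn≡count G S a) (count-cong (within a Sa))) (kdep a (lookup⇒[]= a S Sa))
    where
    within : ∀ a → lookup S a ≡ true → ∀ b → (lookup S b ∧ adj G a b) ≡ (adj G ↾ lookup S) a b
    within a Sa b rewrite Sa = ∧-comm (lookup S b) (adj G a b)

  iterDelete-⊆ : (G : Graph n) (Ms : ℕ → Graph n) → ∀ {i j} → i ≤ j → iterDelete G Ms j ⊆ᴳ iterDelete G Ms i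
  iterDelete-⊆ G Ms {j = zero}  z≤n     a b = λ Gab → Gab
  iterDelete-⊆ G Ms {j = suc j} i≤1+j a b with m≤n⇒m<n∨m≡n i≤1+j
  ... | inj₁ i<1+j = iterDelete-⊆ G Ms (≤-pred i<1+j) a b ∘ deleteEdges-⊆ (iterDelete G Ms j) (Ms j) a b
  ... | inj₂ refl  = λ Rab → Rab

  iterDelete-telescope : (G : Graph n) (Ms : ℕ → Graph n) (S : Fin n → Bool) {m c : ℕ} (j : ℕ) →
                         (∀ i → i < j → Ms i ⊆ᴳ iterDelete G Ms i) →
                         (∀ i → i < j → m ≤ arcs (adj (Ms i) ↾ S) + c) →
                         j * m + arcs (adj (iterDelete G Ms j) ↾ S) ≤ arcs (adj G ↾ S) + j * c
  iterDelete-telescope G Ms S zero    _   _     = ≤-reflexive (sym (+-identityʳ (arcs (adj G ↾ S))))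
  iterDelete-telescope G Ms S (suc j) sub bound =
    telescope-step j (arcs (adj (iterDelete G Ms (suc j)) ↾ S)) (arcs (adj G ↾ S)) (bound j ≤-refl)
      (arcs-↾-deleteEdges (iterDelete G Ms j) (Ms j) (sub j ≤-refl) S)
      (iterDelete-telescope G Ms S j (λ i → sub i ∘ m<n⇒m<1+n) (λ i → bound i ∘ m<n⇒m<1+n))

  iterDelete-bound : (G : Graph n) (Ms : ℕ → Graph n) (S : Fin n → Bool) (k : ℕ) →
                     (∀ i → i < k → IsMaxMatching (iterDelete G Ms i) (Ms i)) →
                     {N : Graph n} → IsMatching (iterDelete G Ms k) N →
                     suc k * arcs (adj N) ≤ arcs (adj G ↾ S) + suc k * (2 * count (∁ S))
  iterDelete-bound G Ms S k maxMatching {N} isN =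
    ≤-trans (m≤m+n (suc k * arcs (adj N)) 0)
      (telescope-step k 0 (arcs (adj G ↾ S)) N≤Rₖ refl
        (iterDelete-telescope G Ms S k (λ i → proj₁ ∘ proj₁ ∘ maxMatching i) N≤Mᵢ))
    where
    Rₖ = iterDelete G Ms k
    N≤Rₖ : arcs (adj N) ≤ arcs (adj Rₖ ↾ S) + 2 * count (∁ S)
    N≤Rₖ = ≤-trans (matching-arcs≤ {G = Rₖ} {M = N} isN S)
                   (+-monoˡ-≤ (2 * count (∁ S)) (arcs-↾-mono {H = N} {G = Rₖ} (proj₁ isN) S))
    N≤Mᵢ : ∀ i → i < k → arcs (adj N) ≤ arcs (adj (Ms i) ↾ S) + 2 * count (∁ S)
    N≤Mᵢ i i<k = begin
      arcs (adj N)                              ≤⟨ maxMatching-arcs {H = Rᵢ} {M = Ms i} {N = N} maxᵢ N-matchesRᵢ ⟩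
      arcs (adj (Ms i))                         ≤⟨ matching-arcs≤ {G = Rᵢ} {M = Ms i} (proj₁ maxᵢ) S ⟩
      arcs (adj (Ms i) ↾ S) + 2 * count (∁ S)   ∎
      where
      open ≤-Reasoning
      Rᵢ = iterDelete G Ms i
      maxᵢ = maxMatching i i<k
      N-matchesRᵢ : IsMatching Rᵢ N
      N-matchesRᵢ = matching-⊆ {H = Rₖ} {G = Rᵢ} {M = N} (iterDelete-⊆ G Ms (<⇒≤ i<k)) isN

lemma3 : (k : ℕ) → 1 ≤ k → (n : ℕ) → (G : Graph n) → IsBipartite G →
         (Ms : ℕ → Graph n) →
         (∀ i → i < k → IsMaxMatching (iterDelete G Ms i) (Ms i)) →
         (I Istar : Subset n) →
         IsMaxIndependent (iterDelete G Ms k) I →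
         IsMaxKDependent k G Istar →
         (k + 2) * ∣ Istar ∣ ≤ 2 * (k + 1) * ∣ I ∣
-- The argument does not need 1 ≤ k.
lemma3 k _ n G bipartite Ms maxMatching I Istar (_ , maximumI) (kDependent , _) =
  subst (λ s → (k + 2) * s ≤ 2 * (k + 1) * ∣ I ∣) (sym (∣∣≡count Istar))
    (≤-trans (approximation-bound k partition cover≤matching ratio) (*-monoʳ-≤ (2 * (k + 1)) C̅≤I))
  where
  S = lookup Istar
  Gₖ = iterDelete G Ms k
  open KőnigPair (kőnig Gₖ (bipartite-⊆ {H = Gₖ} {G = G} (iterDelete-⊆ G Ms {j = k} z≤n) bipartite))
    renaming (matching to N; cover to C)
  ratio : suc k * arcs (adj N) ≤ k * count S + suc k * (2 * count (∁ S))
  ratio = ≤-trans (iterDelete-bound G Ms S k maxMatching {N} isMatching)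
                  (+-monoˡ-≤ (suc k * (2 * count (∁ S))) (kDependent-arcs k G Istar kDependent))
  partition : count C + count (∁ C) ≡ count S + count (∁ S)
  partition = trans (count-∁ C) (sym (count-∁ S))
  C̅≤I : count (∁ C) ≤ ∣ I ∣
  C̅≤I = subst (_≤ ∣ I ∣) (∣toSubset∣≡count (∁ C))
              (maximumI _ (cover-complement-independent {G = Gₖ} {C = C} isCover))
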